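{- Let $k\ge1$ and let $\omega$ be a weight vector. For every $n\ge1$, $$P_{k,n,\omega}=t_1P_{k,n-1,\omega}+t_2P_{k,n-2,\omega}+\cdots+t_{n-1}P_{k,1,\omega}+\omega_nt_n,$$ with the conventions $t_j=0$ and $\omega_j=0$ for $j>k$.
   Context: Let $t_1,\ldots,t_k$ be indeterminates, $t^\alpha=t_1^{\alpha_1}\cdots t_k^{\alpha_k}$ for $\alpha\in\mathbb{Z}_{\ge0}^k$, $|\alpha|=\sum_i\alpha_i$, and $\alpha\vdash n$ means $\sum_i i\alpha_i=n$. Let $e_j$ be the $j$-th unit vector. For a weight vector $\omega=(\omega_1,\ldots,\omega_k)$ (rational entries) define $A_\omega(e_j)=\omega_j$ and, for $|\alpha|\ge2$, $A_\omega(\alpha)=\sum_{j:\alpha_j\ge1}A_\omega(\alpha-e_j)$. The weighted isobaric polynomial of level $n$ and weight $\omega$ is $P_{k,n,\omega}=\sum_{\alpha\vdash n}A_\omega(\alpha)t^\alpha$. -}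

module Defs where

open import Data.Nat using (ℕ; zero; suc; _∸_; _≤_) renaming (_≟_ to _≟ℕ_)
open import Data.Nat.Properties using (_≤?_)
open import Data.Fin using (Fin; toℕ) renaming (zero to fz; suc to fs)
open import Data.Fin.Properties using () renaming (_≟_ to _≟F_)
open import Data.Bool using (Bool; true; false; if_then_else_; _∧_)
open import Data.Rational using (ℚ; 0ℚ; 1ℚ; _+_; _*_)
open import Relation.Nullary using (does)
open import Relation.Binary.PropositionalEquality using (_≡_)

-- Exponent vectors α ∈ ℤ≥0^k, coordinates indexed by Fin k
-- (coordinate i : Fin k corresponds to variable t_{toℕ i + 1}).
Exp : ℕ → Set
Exp k = Fin k → ℕ

-- A polynomial in t_1..t_k over ℚ, represented by its coefficient function
-- α ↦ coefficient of t^α.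
Poly : ℕ → Set
Poly k = Exp k → ℚ

ΣF : ∀ {A : Set} (_⊕_ : A → A → A) (e : A) {k : ℕ} → (Fin k → A) → A
ΣF _⊕_ e {zero}  f = e
ΣF _⊕_ e {suc k} f = f fz ⊕ ΣF _⊕_ e (λ i → f (fs i))

sumℚ : ∀ {k} → (Fin k → ℚ) → ℚ
sumℚ = ΣF _+_ 0ℚ

sumℕ : ∀ {k} → (Fin k → ℕ) → ℕ
sumℕ = ΣF Data.Nat._+_ 0

allF : ∀ {k} → (Fin k → Bool) → Bool
allF = ΣF _∧_ true

[_]ℚ : Bool → ℚ
[ b ]ℚ = if b then 1ℚ else 0ℚ

∣_∣ₑ : ∀ {k} → Exp k → ℕ
∣ α ∣ₑ = sumℕ α

-- Σ_i i α_i  (1-based index i), so that  α ⊢ n  iff  level α ≡ n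
level : ∀ {k} → Exp k → ℕ
level α = sumℕ (λ i → suc (toℕ i) Data.Nat.* α i)

_−e_ : ∀ {k} → Exp k → Fin k → Exp k
(α −e i) j = if does (j ≟F i) then α j ∸ 1 else α j

pos : ∀ {k} → Exp k → Fin k → Bool
pos α i = does (1 ≤? α i)

isUnit : ∀ {k} → Exp k → Fin k → Bool
isUnit α i = allF (λ j → does (α j ≟ℕ (if does (j ≟F i) then 1 else 0)))

-- A_ω with fuel m (meant to be called with m = |α|):
--   A_ω(e_j) = ω_j ;  A_ω(α) = Σ_{j : α_j ≥ 1} A_ω(α - e_j)  for |α| ≥ 2.
-- For |α| = 1 we have α = e_j, so the base case is written as
-- Σ_{j : α = e_j} ω_j.  (A_ω(0) is not used; it is set to 0.)
Afuel : ∀ {k} → (Fin k → ℚ) → ℕ → Exp k → ℚ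
Afuel ω zero          α = 0ℚ
Afuel ω (suc zero)    α = sumℚ (λ j → [ isUnit α j ]ℚ * ω j)
Afuel ω (suc (suc m)) α = sumℚ (λ j → [ pos α j ]ℚ * Afuel ω (suc m) (α −e j))

A : ∀ {k} → (Fin k → ℚ) → Exp k → ℚ
A ω α = Afuel ω ∣ α ∣ₑ α

P : (k n : ℕ) → (Fin k → ℚ) → Poly k
P k n ω α = [ does (level α ≟ℕ n) ]ℚ * A ω α

_⊕_ : ∀ {k} → Poly k → Poly k → Poly k
(p ⊕ q) α = p α + q α

0ₚ : ∀ {k} → Poly k
0ₚ α = 0ℚ

1ₚ : ∀ {k} → Poly k
1ₚ α = [ allF (λ j → does (α j ≟ℕ 0)) ]ℚ

_·ₚ_ : ∀ {k} → ℚ → Poly k → Poly k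
(c ·ₚ p) α = c * p α

-- Multiplication by t_j (j ≥ 1, 1-based), with the convention t_j = 0 for j > k:
-- coefficient of t^α in t_j p is p(α - e_j) if α_j ≥ 1, and 0 otherwise.
tmul : ∀ {k} → ℕ → Poly k → Poly k
tmul {k} j p α = sumℚ (λ i → [ does (suc (toℕ i) ≟ℕ j) ]ℚ * ([ pos α i ]ℚ * p (α −e i)))

tvar : ∀ {k} → ℕ → Poly k
tvar j = tmul j 1ₚ

-- ω_j (1-based), with the convention ω_j = 0 for j > k.
wt : ∀ {k} → (Fin k → ℚ) → ℕ → ℚ
wt ω j = sumℚ (λ i → [ does (suc (toℕ i) ≟ℕ j) ]ℚ * ω i)

sumTo : ∀ {k} → ℕ → (ℕ → Poly k) → Poly k
sumTo zero    f = 0ₚ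
sumTo (suc m) f = sumTo m f ⊕ f (suc m)

_≈ₚ_ : ∀ {k} → Poly k → Poly k → Set
p ≈ₚ q = ∀ α → p α ≡ q α

{-# OPTIONS --safe #-}
module Submission where

open import Defs
open import Data.Nat using (ℕ; suc; _∸_; _≥_)
open import Data.Fin using (Fin)
open import Data.Rational using (ℚ)

open import Algebra.Bundles using (CommutativeMonoid)
open import Data.Bool using (Bool; true; false; if_then_else_)
open import Data.Bool.Properties using (∧-zeroʳ)
open import Data.Fin using (toℕ) renaming (zero to fz; suc to fs)
open import Data.Fin.Properties using () renaming (_≟_ to _≟F_)
open import Data.Nat as ℕ using (zero; _≤_) renaming (_≟_ to _≟ℕ_)
open import Data.Nat.Properties as ℕ using (_≤?_)
open import Data.Nat.Solver using (module +-*-Solver)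
open import Data.Rational using (0ℚ; 1ℚ; _+_; _*_)
open import Data.Rational.Properties
  using ( +-identityˡ; +-identityʳ; *-identityˡ; *-identityʳ; *-zeroˡ; *-zeroʳ; *-distribˡ-+
        ; *-1-commutativeMonoid; +-0-commutativeMonoid)
open import Data.Sum using (inj₂; [_,_])
open import Function using (_∘_)
open import Function.Bundles using (_⇔_; mk⇔; module Equivalence)
open import Relation.Nullary using (Dec; yes; no; does; ¬_; contradiction)
open import Relation.Nullary.Decidable using (dec-true; dec-false; does-⇔)
open import Relation.Binary.PropositionalEquality
open ≡-Reasoning

open import Algebra.Properties.CommutativeSemigroup
  (CommutativeMonoid.commutativeSemigroup *-1-commutativeMonoid) using (x∙yz≈y∙xz)

-- Index f : Fin k stands for the variable t_{f+1}; write α' = α − e_f. Folding the base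
-- case into the recursion gives, for every α (and with A_ω(0) = 0),
--   A_ω(α) = Σ_{f : α_f ≥ 1} (A_ω(α') + ω_f [α' = 0]),
-- while the coefficient of t^α in t_{f+1} P_{k,n-f-1,ω} is [α_f ≥ 1] [α' ⊢ n-f-1] A_ω(α').
-- Since level α = level α' + f + 1, on the f-th summand the condition α ⊢ n becomes
-- α' ⊢ n-f-1 when f + 1 < n, giving t_{f+1} P_{k,n-f-1,ω}; when f + 1 ≥ n it forces
-- f + 1 = n and α' = 0, leaving only ω_n [α = e_n], i.e. the term ω_n t_n.

private
  variable
    k : ℕ

⟦_⟧ : ∀ {A : Set} → Dec A → ℚ
⟦ a? ⟧ = [ does a? ]ℚ

guard-cong : ∀ {A : Set} (a? : Dec A) {x y : ℚ} → (A → x ≡ y) → ⟦ a? ⟧ * x ≡ ⟦ a? ⟧ * y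
guard-cong (yes a) x≡y = cong (1ℚ *_) (x≡y a)
guard-cong (no _) {x} {y} _ = trans (*-zeroˡ x) (sym (*-zeroˡ y))

guard-⊥ : ∀ {A : Set} (a? : Dec A) (x : ℚ) → ¬ A → ⟦ a? ⟧ * x ≡ 0ℚ
guard-⊥ a? x ¬a rewrite dec-false a? ¬a = *-zeroˡ x

ΣF-cong : ∀ {A : Set} (_⊕_ : A → A → A) (e : A) {f g : Fin k → A} →
          (∀ i → f i ≡ g i) → ΣF _⊕_ e f ≡ ΣF _⊕_ e g
ΣF-cong {zero}  _⊕_ e f≗g = refl
ΣF-cong {suc k} _⊕_ e f≗g = cong₂ _⊕_ (f≗g fz) (ΣF-cong _⊕_ e (f≗g ∘ fs))

sumℚ-cong : {f g : Fin k → ℚ} → (∀ i → f i ≡ g i) → sumℚ f ≡ sumℚ g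
sumℚ-cong = ΣF-cong _+_ 0ℚ

sumℕ-cong : {f g : Fin k → ℕ} → (∀ i → f i ≡ g i) → sumℕ f ≡ sumℕ g
sumℕ-cong = ΣF-cong ℕ._+_ 0

sumℚ-zero : (f : Fin k → ℚ) → (∀ i → f i ≡ 0ℚ) → sumℚ f ≡ 0ℚ
sumℚ-zero {zero}  f f≗0 = refl
sumℚ-zero {suc k} f f≗0 =
  trans (cong₂ _+_ (f≗0 fz) (sumℚ-zero (f ∘ fs) (f≗0 ∘ fs))) (+-identityˡ 0ℚ)

sumℚ-distrib-+ : (f g : Fin k → ℚ) → sumℚ (λ i → f i + g i) ≡ sumℚ f + sumℚ g
sumℚ-distrib-+ {zero}  f g = sym (+-identityˡ 0ℚ)
sumℚ-distrib-+ {suc k} f g = begin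
  (f fz + g fz) + sumℚ (λ i → f (fs i) + g (fs i))
    ≡⟨ cong (f fz + g fz +_) (sumℚ-distrib-+ (f ∘ fs) (g ∘ fs)) ⟩
  (f fz + g fz) + (sumℚ (f ∘ fs) + sumℚ (g ∘ fs))
    ≡⟨ interchange (f fz) (g fz) _ _ ⟩
  (f fz + sumℚ (f ∘ fs)) + (g fz + sumℚ (g ∘ fs)) ∎
  where open import Algebra.Properties.CommutativeSemigroup
          (CommutativeMonoid.commutativeSemigroup +-0-commutativeMonoid) using (interchange)

*-distribˡ-sumℚ : (c : ℚ) (f : Fin k → ℚ) → c * sumℚ f ≡ sumℚ (λ i → c * f i)
*-distribˡ-sumℚ {zero}  c f = *-zeroʳ c
*-distribˡ-sumℚ {suc k} c f =
  trans (*-distribˡ-+ c (f fz) _) (cong (c * f fz +_) (*-distribˡ-sumℚ c (f ∘ fs)))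

sumℕ≡0⇒ : (f : Fin k → ℕ) → sumℕ f ≡ 0 → ∀ i → f i ≡ 0
sumℕ≡0⇒ f Σf≡0 fz     = ℕ.m+n≡0⇒m≡0 (f fz) Σf≡0
sumℕ≡0⇒ f Σf≡0 (fs i) = sumℕ≡0⇒ (f ∘ fs) (ℕ.m+n≡0⇒n≡0 (f fz) Σf≡0) i

sumℕ≡0⇐ : (f : Fin k → ℕ) → (∀ i → f i ≡ 0) → sumℕ f ≡ 0
sumℕ≡0⇐ {zero}  f f≗0 = refl
sumℕ≡0⇐ {suc k} f f≗0 = cong₂ ℕ._+_ (f≗0 fz) (sumℕ≡0⇐ (f ∘ fs) (f≗0 ∘ fs))

allF-true : (p : Fin k → Bool) → (∀ i → p i ≡ true) → allF p ≡ true
allF-true {zero}  p p≗true = refl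
allF-true {suc k} p p≗true rewrite p≗true fz = allF-true (p ∘ fs) (p≗true ∘ fs)

allF-false : (p : Fin k → Bool) (j : Fin k) → p j ≡ false → allF p ≡ false
allF-false p fz     pj≡false rewrite pj≡false = refl
allF-false p (fs j) pj≡false rewrite allF-false (p ∘ fs) j pj≡false = ∧-zeroʳ (p fz)

−e-same : (α : Exp k) (j : Fin k) → (α −e j) j ≡ α j ∸ 1
−e-same α j with j ≟F j
... | yes _  = refl
... | no j≢j = contradiction refl j≢j

−e-other : (α : Exp k) {i j : Fin k} → i ≢ j → (α −e j) i ≡ α i
−e-other α {i} {j} i≢j with i ≟F j
... | yes i≡j = contradiction i≡j i≢j
... | no _    = refl

weighted-−e : (w : Fin k → ℕ) (α : Exp k) (f : Fin k) → 1 ≤ α f →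
              sumℕ (λ i → w i ℕ.* α i) ≡ sumℕ (λ i → w i ℕ.* (α −e f) i) ℕ.+ w f
weighted-−e {suc k} w α fz 1≤α₀ = begin
  w fz ℕ.* α fz ℕ.+ R
    ≡⟨ cong (λ a → w fz ℕ.* a ℕ.+ R) (sym (ℕ.m∸n+n≡m 1≤α₀)) ⟩
  w fz ℕ.* (α fz ∸ 1 ℕ.+ 1) ℕ.+ R
    ≡⟨ solve 3 (λ w a r → w :* (a :+ con 1) :+ r := (w :* a :+ r) :+ w) refl (w fz) (α fz ∸ 1) R ⟩
  (w fz ℕ.* (α fz ∸ 1) ℕ.+ R) ℕ.+ w fz ∎
  where
  open +-*-Solver
  R : ℕ
  R = sumℕ (λ i → w (fs i) ℕ.* α (fs i))
weighted-−e {suc k} w α (fs f) 1≤αf = begin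
  w fz ℕ.* α fz ℕ.+ sumℕ (λ i → w (fs i) ℕ.* α (fs i))
    ≡⟨ cong (w fz ℕ.* α fz ℕ.+_) (weighted-−e (w ∘ fs) (α ∘ fs) f 1≤αf) ⟩
  w fz ℕ.* α fz ℕ.+ (sumℕ (λ i → w (fs i) ℕ.* (α −e fs f) (fs i)) ℕ.+ w (fs f))
    ≡⟨ sym (ℕ.+-assoc (w fz ℕ.* α fz) _ (w (fs f))) ⟩
  w fz ℕ.* α fz ℕ.+ sumℕ (λ i → w (fs i) ℕ.* (α −e fs f) (fs i)) ℕ.+ w (fs f) ∎

size-−e : (α : Exp k) (f : Fin k) → 1 ≤ α f → ∣ α ∣ₑ ≡ suc ∣ α −e f ∣ₑ
size-−e α f 1≤αf = begin
  ∣ α ∣ₑ                                   ≡⟨ sumℕ-cong (λ i → sym (ℕ.*-identityˡ (α i))) ⟩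
  sumℕ (λ i → 1 ℕ.* α i)                   ≡⟨ weighted-−e (λ _ → 1) α f 1≤αf ⟩
  sumℕ (λ i → 1 ℕ.* (α −e f) i) ℕ.+ 1      ≡⟨ cong (ℕ._+ 1) (sumℕ-cong (λ i → ℕ.*-identityˡ ((α −e f) i))) ⟩
  ∣ α −e f ∣ₑ ℕ.+ 1                        ≡⟨ ℕ.+-comm ∣ α −e f ∣ₑ 1 ⟩
  suc ∣ α −e f ∣ₑ                          ∎

level-−e : (α : Exp k) (f : Fin k) → 1 ≤ α f → level α ≡ level (α −e f) ℕ.+ suc (toℕ f)
level-−e α = weighted-−e (λ i → suc (toℕ i)) α

size≡0⇔level≡0 : (β : Exp k) → ∣ β ∣ₑ ≡ 0 ⇔ level β ≡ 0
size≡0⇔level≡0 β = mk⇔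
  (λ ∣β∣≡0 → sumℕ≡0⇐ _ (λ i →
    trans (cong (suc (toℕ i) ℕ.*_) (sumℕ≡0⇒ β ∣β∣≡0 i)) (ℕ.*-zeroʳ (suc (toℕ i)))))
  (λ lvβ≡0 → sumℕ≡0⇐ β (λ i → coordinate≡0 i (sumℕ≡0⇒ _ lvβ≡0 i)))
  where
  coordinate≡0 : ∀ i → suc (toℕ i) ℕ.* β i ≡ 0 → β i ≡ 0
  coordinate≡0 i e with ℕ.m*n≡0⇒m≡0∨n≡0 (suc (toℕ i)) e
  ... | inj₂ βi≡0 = βi≡0

allF-isZero : (β : Exp k) → allF (λ j → does (β j ≟ℕ 0)) ≡ does (∣ β ∣ₑ ≟ℕ 0)
allF-isZero {zero}  β = refl
allF-isZero {suc k} β with β fz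
... | zero  = allF-isZero (β ∘ fs)
... | suc _ = refl

1ₚ-size : (β : Exp k) → 1ₚ β ≡ ⟦ ∣ β ∣ₑ ≟ℕ 0 ⟧
1ₚ-size β = cong [_]ℚ (allF-isZero β)

1ₚ-level : (β : Exp k) → 1ₚ β ≡ ⟦ level β ≟ℕ 0 ⟧
1ₚ-level β = trans (1ₚ-size β) (cong [_]ℚ (does-⇔ (size≡0⇔level≡0 β) (∣ β ∣ₑ ≟ℕ 0) (level β ≟ℕ 0)))

A-level≡0 : (ω : Fin k → ℚ) (β : Exp k) → level β ≡ 0 → A ω β ≡ 0ℚ
A-level≡0 ω β lvβ≡0 = cong (λ m → Afuel ω m β) (Equivalence.from (size≡0⇔level≡0 β) lvβ≡0)

isUnit≡pos : (α : Exp k) (j : Fin k) → ∣ α ∣ₑ ≡ 1 → isUnit α j ≡ pos α j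
isUnit≡pos α j ∣α∣≡1 with 1 ≤? α j
... | no 1≰αj = trans (allF-false _ j αj≢1) (sym (dec-false (1 ≤? α j) 1≰αj))
  where
  unit-at-j : (if does (j ≟F j) then 1 else 0) ≡ 1
  unit-at-j = cong (if_then 1 else 0) (dec-true (j ≟F j) refl)
  αj≢1 : does (α j ≟ℕ (if does (j ≟F j) then 1 else 0)) ≡ false
  αj≢1 = dec-false (α j ≟ℕ _) (λ αj≡1 → 1≰αj (subst (1 ≤_) (sym (trans αj≡1 unit-at-j)) ℕ.≤-refl))
... | yes 1≤αj = trans (allF-true _ (λ i → dec-true (α i ≟ℕ _) (α≡eⱼ i))) (sym (dec-true (1 ≤? α j) 1≤αj))
  where
  rest≡0 : ∀ i → (α −e j) i ≡ 0
  rest≡0 = sumℕ≡0⇒ (α −e j) (ℕ.suc-injective (trans (sym (size-−e α j 1≤αj)) ∣α∣≡1))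
  α≡eⱼ : ∀ i → α i ≡ (if does (i ≟F j) then 1 else 0)
  α≡eⱼ i with i ≟F j
  ... | yes refl = ℕ.≤-antisym (ℕ.m∸n≡0⇒m≤n (trans (sym (−e-same α j)) (rest≡0 j))) 1≤αj
  ... | no i≢j   = trans (sym (−e-other α i≢j)) (rest≡0 i)

A-summand : (Fin k → ℚ) → Exp k → Fin k → ℚ
A-summand ω α f = A ω (α −e f) + ω f * 1ₚ (α −e f)

A-unfold : (ω : Fin k → ℚ) (α : Exp k) → A ω α ≡ sumℚ (λ f → [ pos α f ]ℚ * A-summand ω α f)
A-unfold {k} ω α = Afuel-unfold ∣ α ∣ₑ refl
  where
  A-summand-of-size : ∀ {m} f → ∣ α −e f ∣ₑ ≡ m →
                      A-summand ω α f ≡ Afuel ω m (α −e f) + ω f * ⟦ m ≟ℕ 0 ⟧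
  A-summand-of-size f refl = cong (λ u → A ω (α −e f) + ω f * u) (1ₚ-size (α −e f))

  rest-size : ∀ {m} f → ∣ α ∣ₑ ≡ suc m → 1 ≤ α f → ∣ α −e f ∣ₑ ≡ m
  rest-size f ∣α∣≡1+m 1≤αf = ℕ.suc-injective (trans (sym (size-−e α f 1≤αf)) ∣α∣≡1+m)

  Afuel-unfold : ∀ m → ∣ α ∣ₑ ≡ m → Afuel ω m α ≡ sumℚ (λ f → [ pos α f ]ℚ * A-summand ω α f)
  Afuel-unfold zero ∣α∣≡0 = sym (sumℚ-zero _ (λ f → guard-⊥ (1 ≤? α f) _ (λ 1≤αf →
    contradiction (trans (sym (size-−e α f 1≤αf)) ∣α∣≡0) λ ())))
  Afuel-unfold (suc zero) ∣α∣≡1 = begin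
    sumℚ (λ j → [ isUnit α j ]ℚ * ω j)
      ≡⟨ sumℚ-cong (λ j → cong (λ b → [ b ]ℚ * ω j) (isUnit≡pos α j ∣α∣≡1)) ⟩
    sumℚ (λ j → [ pos α j ]ℚ * ω j)
      ≡⟨ sumℚ-cong (λ j → guard-cong (1 ≤? α j) (λ 1≤αj → sym (begin
           A-summand ω α j ≡⟨ A-summand-of-size j (rest-size j ∣α∣≡1 1≤αj) ⟩
           0ℚ + ω j * 1ℚ   ≡⟨ +-identityˡ (ω j * 1ℚ) ⟩
           ω j * 1ℚ        ≡⟨ *-identityʳ (ω j) ⟩
           ω j             ∎))) ⟩
    sumℚ (λ j → [ pos α j ]ℚ * A-summand ω α j) ∎
  Afuel-unfold (suc (suc m)) ∣α∣≡2+m = sumℚ-cong (λ j → guard-cong (1 ≤? α j) (λ 1≤αj → sym (begin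
    A-summand ω α j                     ≡⟨ A-summand-of-size j (rest-size j ∣α∣≡2+m 1≤αj) ⟩
    Afuel ω (suc m) (α −e j) + ω j * 0ℚ ≡⟨ cong (Afuel ω (suc m) (α −e j) +_) (*-zeroʳ (ω j)) ⟩
    Afuel ω (suc m) (α −e j) + 0ℚ       ≡⟨ +-identityʳ _ ⟩
    Afuel ω (suc m) (α −e j)            ∎)))

tmul-coeff : (j : ℕ) (p : Poly k) (α : Exp k) →
             tmul j p α ≡ sumℚ (λ f → [ pos α f ]ℚ * (⟦ suc (toℕ f) ≟ℕ j ⟧ * p (α −e f)))
tmul-coeff j p α = sumℚ-cong (λ f → x∙yz≈y∙xz ⟦ suc (toℕ f) ≟ℕ j ⟧ [ pos α f ]ℚ (p (α −e f)))

guard-≤-suc : ∀ {s m} (s≤?m : Dec (s ≤ m)) (s≟1+m : Dec (s ≡ suc m)) (s≤?1+m : Dec (s ≤ suc m))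
              (X : ℕ → ℚ) → ⟦ s≤?m ⟧ * X s + ⟦ s≟1+m ⟧ * X (suc m) ≡ ⟦ s≤?1+m ⟧ * X s
guard-≤-suc {m = m} (yes s≤m) (yes refl) _ X = contradiction s≤m (ℕ.n≮n m)
guard-≤-suc {s} {m} (yes s≤m) (no _) s≤?1+m X rewrite dec-true s≤?1+m (ℕ.m≤n⇒m≤1+n s≤m) =
  trans (cong (1ℚ * X s +_) (*-zeroˡ (X (suc m)))) (+-identityʳ (1ℚ * X s))
guard-≤-suc {m = m} (no _) (yes refl) s≤?1+m X rewrite dec-true s≤?1+m ℕ.≤-refl =
  trans (cong (_+ 1ℚ * X (suc m)) (*-zeroˡ (X (suc m)))) (+-identityˡ (1ℚ * X (suc m)))
guard-≤-suc {s} {m} (no s≰m) (no s≢1+m) s≤?1+m X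
  rewrite dec-false s≤?1+m (λ s≤1+m → [ s≰m ∘ ℕ.≤-pred , s≢1+m ] (ℕ.m≤n⇒m<n∨m≡n s≤1+m)) =
  trans (cong₂ _+_ (*-zeroˡ (X s)) (*-zeroˡ (X (suc m))))
        (trans (+-identityˡ 0ℚ) (sym (*-zeroˡ (X s))))

sumTo-tmul : (Q : ℕ → Poly k) (m : ℕ) (α : Exp k) →
             sumTo m (λ i → tmul i (Q i)) α
             ≡ sumℚ (λ f → [ pos α f ]ℚ * (⟦ suc (toℕ f) ≤? m ⟧ * Q (suc (toℕ f)) (α −e f)))
sumTo-tmul Q zero α = sym (sumℚ-zero _ (λ f →
  trans (cong ([ pos α f ]ℚ *_) (*-zeroˡ (Q (suc (toℕ f)) (α −e f)))) (*-zeroʳ [ pos α f ]ℚ)))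
sumTo-tmul {k} Q (suc m) α = begin
  sumTo m (λ i → tmul i (Q i)) α + tmul (suc m) (Q (suc m)) α
    ≡⟨ cong₂ _+_ (sumTo-tmul Q m α) (tmul-coeff (suc m) (Q (suc m)) α) ⟩
  sumℚ old + sumℚ new
    ≡⟨ sym (sumℚ-distrib-+ old new) ⟩
  sumℚ (λ f → old f + new f)
    ≡⟨ sumℚ-cong (λ f → trans (sym (*-distribˡ-+ [ pos α f ]ℚ _ _))
         (cong ([ pos α f ]ℚ *_) (guard-≤-suc (s f ≤? m) (s f ≟ℕ suc m) (s f ≤? suc m) (X f)))) ⟩
  sumℚ (λ f → [ pos α f ]ℚ * (⟦ s f ≤? suc m ⟧ * X f (s f))) ∎
  where
  s : Fin k → ℕ
  s f = suc (toℕ f)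
  X : Fin k → ℕ → ℚ
  X f i = Q i (α −e f)
  old new : Fin k → ℚ
  old f = [ pos α f ]ℚ * (⟦ s f ≤? m ⟧ * X f (s f))
  new f = [ pos α f ]ℚ * (⟦ s f ≟ℕ suc m ⟧ * X f (suc m))

wt-suc-toℕ : (ω : Fin k → ℚ) (j : Fin k) → wt ω (suc (toℕ j)) ≡ ω j
wt-suc-toℕ ω fz = begin
  1ℚ * ω fz + sumℚ (λ i → 0ℚ * ω (fs i))
    ≡⟨ cong (1ℚ * ω fz +_) (sumℚ-zero _ (λ i → *-zeroˡ (ω (fs i)))) ⟩
  1ℚ * ω fz + 0ℚ
    ≡⟨ +-identityʳ (1ℚ * ω fz) ⟩
  1ℚ * ω fz
    ≡⟨ *-identityˡ (ω fz) ⟩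
  ω fz ∎
wt-suc-toℕ ω (fs j) = begin
  0ℚ * ω fz + wt (ω ∘ fs) (suc (toℕ j)) ≡⟨ cong (_+ wt (ω ∘ fs) (suc (toℕ j))) (*-zeroˡ (ω fz)) ⟩
  0ℚ + wt (ω ∘ fs) (suc (toℕ j))        ≡⟨ +-identityˡ _ ⟩
  wt (ω ∘ fs) (suc (toℕ j))             ≡⟨ wt-suc-toℕ (ω ∘ fs) j ⟩
  ω (fs j)                              ∎

wt-·-tvar : (ω : Fin k → ℚ) (n : ℕ) (α : Exp k) →
            wt ω n * tvar n α ≡ sumℚ (λ f → [ pos α f ]ℚ * (⟦ suc (toℕ f) ≟ℕ n ⟧ * (ω f * 1ₚ (α −e f))))
wt-·-tvar {k} ω n α = begin
  wt ω n * tvar n α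
    ≡⟨ cong (wt ω n *_) (tmul-coeff n 1ₚ α) ⟩
  wt ω n * sumℚ (λ f → [ pos α f ]ℚ * (δ f * 1ₚ (α −e f)))
    ≡⟨ *-distribˡ-sumℚ (wt ω n) (λ f → [ pos α f ]ℚ * (δ f * 1ₚ (α −e f))) ⟩
  sumℚ (λ f → wt ω n * ([ pos α f ]ℚ * (δ f * 1ₚ (α −e f))))
    ≡⟨ sumℚ-cong (λ f → trans (x∙yz≈y∙xz (wt ω n) [ pos α f ]ℚ _) (cong ([ pos α f ]ℚ *_) (summand f))) ⟩
  sumℚ (λ f → [ pos α f ]ℚ * (δ f * (ω f * 1ₚ (α −e f)))) ∎
  where
  δ : Fin k → ℚ
  δ f = ⟦ suc (toℕ f) ≟ℕ n ⟧
  summand : ∀ f → wt ω n * (δ f * 1ₚ (α −e f)) ≡ δ f * (ω f * 1ₚ (α −e f))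
  summand f = trans (x∙yz≈y∙xz (wt ω n) (δ f) (1ₚ (α −e f)))
    (guard-cong (suc (toℕ f) ≟ℕ n) (λ { refl → cong (_* 1ₚ (α −e f)) (wt-suc-toℕ ω f) }))

+-suc≡suc⇔≡∸ : ∀ {L s n} → s ≤ n → L ℕ.+ suc s ≡ suc n ⇔ L ≡ n ∸ s
+-suc≡suc⇔≡∸ {L} {s} {n} s≤n = mk⇔
  (λ e → trans (sym (ℕ.m+n∸n≡m L s)) (cong (_∸ s) (ℕ.suc-injective (trans (sym (ℕ.+-suc L s)) e))))
  (λ L≡n∸s → trans (ℕ.+-suc L s) (cong suc (trans (cong (ℕ._+ s) L≡n∸s) (ℕ.m∸n+n≡m s≤n))))

guard-level-shift : ∀ {L s n} (X : ℚ) → (L ≡ 0 → X ≡ 0ℚ) →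
                    (L+1+s≟1+n : Dec (L ℕ.+ suc s ≡ suc n)) (s<n? : Dec (suc s ≤ n))
                    (L≟n∸s : Dec (L ≡ n ∸ s)) →
                    ⟦ L+1+s≟1+n ⟧ * X ≡ ⟦ s<n? ⟧ * (⟦ L≟n∸s ⟧ * X)
guard-level-shift X _ L+1+s≟1+n (yes s<n) L≟n∸s =
  trans (cong (λ b → [ b ]ℚ * X) (does-⇔ (+-suc≡suc⇔≡∸ (ℕ.<⇒≤ s<n)) L+1+s≟1+n L≟n∸s))
        (sym (*-identityˡ (⟦ L≟n∸s ⟧ * X)))
guard-level-shift {L} {s} {n} X L≡0⇒X≡0 L+1+s≟1+n (no s≮n) L≟n∸s = begin
  ⟦ L+1+s≟1+n ⟧ * X     ≡⟨ guard-cong L+1+s≟1+n (λ e → L≡0⇒X≡0 (L≡0 L e)) ⟩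
  ⟦ L+1+s≟1+n ⟧ * 0ℚ    ≡⟨ *-zeroʳ ⟦ L+1+s≟1+n ⟧ ⟩
  0ℚ                    ≡⟨ sym (*-zeroˡ (⟦ L≟n∸s ⟧ * X)) ⟩
  0ℚ * (⟦ L≟n∸s ⟧ * X) ∎
  where
  L≡0 : ∀ M → M ℕ.+ suc s ≡ suc n → M ≡ 0
  L≡0 zero    _ = refl
  L≡0 (suc M) e = contradiction (subst (suc s ≤_) (ℕ.suc-injective e) (ℕ.m≤n+m (suc s) M)) s≮n

guard-level-unit : ∀ L s n (x : ℚ) → ⟦ L ℕ.+ s ≟ℕ n ⟧ * (x * ⟦ L ≟ℕ 0 ⟧) ≡ ⟦ s ≟ℕ n ⟧ * (x * ⟦ L ≟ℕ 0 ⟧)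
guard-level-unit zero    s n x = refl
guard-level-unit (suc L) s n x = trans (annihilate ⟦ suc L ℕ.+ s ≟ℕ n ⟧) (sym (annihilate ⟦ s ≟ℕ n ⟧))
  where
  annihilate : ∀ a → a * (x * 0ℚ) ≡ 0ℚ
  annihilate a = trans (cong (a *_) (*-zeroʳ x)) (*-zeroʳ a)

P-summand-split : (ω : Fin k → ℚ) (n : ℕ) (α : Exp k) (f : Fin k) →
  ⟦ level α ≟ℕ suc n ⟧ * ([ pos α f ]ℚ * A-summand ω α f)
  ≡ [ pos α f ]ℚ * (⟦ suc (toℕ f) ≤? n ⟧ * P k (n ∸ toℕ f) ω (α −e f))
    + [ pos α f ]ℚ * (⟦ suc (toℕ f) ≟ℕ suc n ⟧ * (ω f * 1ₚ (α −e f)))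
P-summand-split {k} ω n α f = begin
  ⟦ level α ≟ℕ suc n ⟧ * ([ pos α f ]ℚ * (A ω β + ω f * 1ₚ β))
    ≡⟨ x∙yz≈y∙xz ⟦ level α ≟ℕ suc n ⟧ [ pos α f ]ℚ _ ⟩
  [ pos α f ]ℚ * (⟦ level α ≟ℕ suc n ⟧ * (A ω β + ω f * 1ₚ β))
    ≡⟨ cong ([ pos α f ]ℚ *_) (*-distribˡ-+ ⟦ level α ≟ℕ suc n ⟧ (A ω β) (ω f * 1ₚ β)) ⟩
  [ pos α f ]ℚ * (⟦ level α ≟ℕ suc n ⟧ * A ω β + ⟦ level α ≟ℕ suc n ⟧ * (ω f * 1ₚ β))
    ≡⟨ guard-cong (1 ≤? α f) (λ 1≤αf → cong₂ _+_ (A-part 1≤αf) (unit-part 1≤αf)) ⟩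
  [ pos α f ]ℚ * (⟦ f<n? ⟧ * P k (n ∸ toℕ f) ω β + ⟦ f≟n ⟧ * (ω f * 1ₚ β))
    ≡⟨ *-distribˡ-+ [ pos α f ]ℚ _ _ ⟩
  [ pos α f ]ℚ * (⟦ f<n? ⟧ * P k (n ∸ toℕ f) ω β) + [ pos α f ]ℚ * (⟦ f≟n ⟧ * (ω f * 1ₚ β)) ∎
  where
  β : Exp k
  β = α −e f
  f<n? : Dec (suc (toℕ f) ≤ n)
  f<n? = suc (toℕ f) ≤? n
  f≟n : Dec (suc (toℕ f) ≡ suc n)
  f≟n = suc (toℕ f) ≟ℕ suc n

  A-part : 1 ≤ α f → ⟦ level α ≟ℕ suc n ⟧ * A ω β ≡ ⟦ f<n? ⟧ * P k (n ∸ toℕ f) ω β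
  A-part 1≤αf = trans (cong (λ v → ⟦ v ≟ℕ suc n ⟧ * A ω β) (level-−e α f 1≤αf))
    (guard-level-shift (A ω β) (A-level≡0 ω β)
                       (level β ℕ.+ suc (toℕ f) ≟ℕ suc n) f<n? (level β ≟ℕ n ∸ toℕ f))

  unit-part : 1 ≤ α f → ⟦ level α ≟ℕ suc n ⟧ * (ω f * 1ₚ β) ≡ ⟦ f≟n ⟧ * (ω f * 1ₚ β)
  unit-part 1≤αf = begin
    ⟦ level α ≟ℕ suc n ⟧ * (ω f * 1ₚ β)
      ≡⟨ cong₂ (λ v u → ⟦ v ≟ℕ suc n ⟧ * (ω f * u)) (level-−e α f 1≤αf) (1ₚ-level β) ⟩
    ⟦ level β ℕ.+ suc (toℕ f) ≟ℕ suc n ⟧ * (ω f * ⟦ level β ≟ℕ 0 ⟧)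
      ≡⟨ guard-level-unit (level β) (suc (toℕ f)) (suc n) (ω f) ⟩
    ⟦ f≟n ⟧ * (ω f * ⟦ level β ≟ℕ 0 ⟧)
      ≡⟨ cong (λ u → ⟦ f≟n ⟧ * (ω f * u)) (sym (1ₚ-level β)) ⟩
    ⟦ f≟n ⟧ * (ω f * 1ₚ β) ∎

theorem8 : (k : ℕ) → k ≥ 1 → (ω : Fin k → ℚ) → (n : ℕ) → n ≥ 1 →
    P k n ω ≈ₚ (sumTo (n ∸ 1) (λ i → tmul i (P k (n ∸ i) ω)) ⊕ (wt ω n ·ₚ tvar n))
theorem8 k _ ω (suc n) _ α = begin
  ⟦ level α ≟ℕ suc n ⟧ * A ω α
    ≡⟨ cong (⟦ level α ≟ℕ suc n ⟧ *_) (A-unfold ω α) ⟩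
  ⟦ level α ≟ℕ suc n ⟧ * sumℚ summand
    ≡⟨ *-distribˡ-sumℚ ⟦ level α ≟ℕ suc n ⟧ summand ⟩
  sumℚ (λ f → ⟦ level α ≟ℕ suc n ⟧ * summand f)
    ≡⟨ sumℚ-cong (P-summand-split ω n α) ⟩
  sumℚ (λ f → lower f + top f)
    ≡⟨ sumℚ-distrib-+ lower top ⟩
  sumℚ lower + sumℚ top
    ≡⟨ sym (cong₂ _+_ (sumTo-tmul (λ i → P k (suc n ∸ i) ω) n α) (wt-·-tvar ω (suc n) α)) ⟩
  sumTo n (λ i → tmul i (P k (suc n ∸ i) ω)) α + wt ω (suc n) * tvar (suc n) α ∎
  where
  summand lower top : Fin k → ℚ
  summand f = [ pos α f ]ℚ * A-summand ω α f
  lower f = [ pos α f ]ℚ * (⟦ suc (toℕ f) ≤? n ⟧ * P k (n ∸ toℕ f) ω (α −e f))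
  top f = [ pos α f ]ℚ * (⟦ suc (toℕ f) ≟ℕ suc n ⟧ * (ω f * 1ₚ (α −e f)))
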